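{- Let $G$ be a graph with Hamilton cycle $H$ and auxiliary graph $A=A(G,H)$, and let $S\subseteq A$ be a disjoint union of colour-alternating cycles without neighbouring vertices. If $F(S)$ has more than one connected component, then at least one vertex of $S$ separates components of $F(S)$.
   Context: For a graph $G$ on $n$ vertices with Hamilton cycle $H=v_1v_2\dots v_nv_1$ (indices mod $n$), write $e_i=v_iv_{i+1}$; an inner edge is an edge of $G$ not in $H$. The auxiliary graph $A=A(G,H)$ is the $2$-edge-coloured graph on $\{e_1,\dots,e_n\}$ with a red edge $e_ie_j$ iff $v_{i+1}v_{j+1}$ is an inner edge of $G$ and a blue edge $e_ie_j$ iff $v_iv_j$ is an inner edge (a pair may get both colours). For a red edge $\ell=e_ie_j$ put $e(\ell)=v_{i+1}v_{j+1}$; for a blue one $e(\ell)=v_iv_j$. A subgraph $S$ of $A$ is a disjoint union of colour-alternating cycles if every vertex of $S$ is incident in $S$ to exactly one red and one blue edge of $S$; it has no neighbouring vertices if no two of its vertices are $e_i,e_{i+1}$ (indices mod $n$). Then $F(S)$ is the spanning subgraph of $G$ with edge set $(\{e_1,\dots,e_n\}\setminus V(S))\cup\{e(\ell):\ell\in E(S)\}$. A vertex $e_k$ of $A$ separates components of $F(S)$ if $v_k$ and $v_{k+1}$ lie in different connected components of $F(S)$. -}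

module Defs where

open import Data.Nat using (ℕ; zero; suc; _≤_; _%_)
open import Data.Nat.DivMod using (m%n<n)
open import Data.Fin using (Fin; toℕ; fromℕ<)
open import Data.Bool using (Bool; true; false)
open import Data.Product using (Σ; ∃; ∃-syntax; _×_; _,_)
open import Data.Sum using (_⊎_)
open import Relation.Nullary using (¬_)
open import Relation.Binary.PropositionalEquality using (_≡_)
open import Function.Definitions using (Injective)

next : {m : ℕ} → Fin (suc m) → Fin (suc m)
next {m} i = fromℕ< (m%n<n (suc (toℕ i)) (suc m))

record Graph (n : ℕ) : Set where
  field
    adj   : Fin n → Fin n → Bool
    sym   : ∀ x y → adj x y ≡ adj y x
    irref : ∀ x → adj x x ≡ false

Edge : {n : ℕ} → Graph n → Fin n → Fin n → Set
Edge G x y = Graph.adj G x y ≡ true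

record HamCycle {m : ℕ} (G : Graph (suc m)) : Set where
  field
    v     : Fin (suc m) → Fin (suc m)
    v-inj : Injective _≡_ _≡_ v
    v-adj : ∀ i → Edge G (v i) (v (next i))

module _ {m : ℕ} {G : Graph (suc m)} (H : HamCycle G) where
  open HamCycle H

  HEdge : Fin (suc m) → Fin (suc m) → Set
  HEdge x y = ∃[ k ] ((x ≡ v k × y ≡ v (next k)) ⊎ (y ≡ v k × x ≡ v (next k)))

  Inner : Fin (suc m) → Fin (suc m) → Set
  Inner x y = Edge G x y × ¬ HEdge x y

  -- edges of the auxiliary graph A(G,H) on {e_i} (identified with indices i)
  RedA : Fin (suc m) → Fin (suc m) → Set
  RedA i j = Inner (v (next i)) (v (next j))

  BlueA : Fin (suc m) → Fin (suc m) → Set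
  BlueA i j = Inner (v i) (v j)

  record SubA : Set where
    field
      inV      : Fin (suc m) → Bool
      red      : Fin (suc m) → Fin (suc m) → Bool
      blue     : Fin (suc m) → Fin (suc m) → Bool
      red-sym  : ∀ i j → red i j ≡ red j i
      blue-sym : ∀ i j → blue i j ≡ blue j i
      red-A    : ∀ i j → red i j ≡ true → RedA i j × inV i ≡ true × inV j ≡ true
      blue-A   : ∀ i j → blue i j ≡ true → BlueA i j × inV i ≡ true × inV j ≡ true

  ExactlyOne : (Fin (suc m) → Bool) → Set
  ExactlyOne f = ∃[ j ] (f j ≡ true × (∀ k → f k ≡ true → k ≡ j))

  AltCycles : SubA → Set
  AltCycles S = ∀ i → SubA.inV S i ≡ true →
                ExactlyOne (SubA.red S i) × ExactlyOne (SubA.blue S i)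

  NoNeighbouring : SubA → Set
  NoNeighbouring S = ∀ i → SubA.inV S i ≡ true → ¬ (SubA.inV S (next i) ≡ true)

  FEdge : SubA → Fin (suc m) → Fin (suc m) → Set
  FEdge S x y =
      (∃[ k ] (SubA.inV S k ≡ false ×
        ((x ≡ v k × y ≡ v (next k)) ⊎ (y ≡ v k × x ≡ v (next k)))))
    ⊎ ((∃[ i ] ∃[ j ] (SubA.red S i j ≡ true × x ≡ v (next i) × y ≡ v (next j)))
    ⊎ (∃[ i ] ∃[ j ] (SubA.blue S i j ≡ true × x ≡ v i × y ≡ v j)))

  data Reach (S : SubA) : Fin (suc m) → Fin (suc m) → Set where
    here : ∀ {x} → Reach S x x
    step : ∀ {x y z} → FEdge S x y → Reach S y z → Reach S x z

  Disconnected : SubA → Set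
  Disconnected S = ∃[ x ] ∃[ y ] ¬ Reach S x y

  Separates : SubA → Fin (suc m) → Set
  Separates S k = ¬ Reach S (v k) (v (next k))

-- Take a vertex x whose component C in F(S)
-- misses some vertex.  Walking once around H we meet an edge e_k = v_k v_{k+1} with
-- v_k ∈ C and v_{k+1} ∉ C.  Since C is closed under the edges of F(S), e_k is not an
-- edge of F(S), so e_k ∈ S, and e_k separates components by the choice of k.
-- Constructively, C has to be computed: it is grown from {x} one outgoing edge at a
-- time, which terminates because the subsets of a finite set are well-founded under ⊃.
module Submission where

open import Defs
open import Data.Nat using (ℕ; suc; _≤_)
open import Data.Bool using (true)
open import Data.Product using (∃-syntax; _×_)
open import Relation.Binary.PropositionalEquality using (_≡_)

open import Level using (Level)
open import Data.Nat using (zero; _+_; _%_; z≤n; s≤s)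
open import Data.Nat.Properties using (1+n≰n; ≤-trans; m≤n⇒m<n∨m≡n; m≤n+m; <⇒≤)
open import Data.Nat.DivMod using (m%n<n; m<n⇒m%n≡m; [m+n]%n≡m%n; %-distribˡ-+; m%n%n≡m%n)
open import Data.Bool using (false)
open import Data.Bool.Properties using (¬-not) renaming (_≟_ to _≟ᵇ_)
open import Data.Fin using (Fin; toℕ; fromℕ<; punchOut)
open import Data.Fin.Properties
  using (any?; toℕ-fromℕ<; toℕ-injective; toℕ<n; injective⇒≤; punchOut-injective)
  renaming (_≟_ to _≟ᶠ_)
open import Data.Fin.Subset using (Subset; _∈_; _⊂_; _⊃_; _∪_; ⁅_⁆)
open import Data.Fin.Subset.Properties using (_∈?_; x∈⁅x⁆; x∈⁅y⁆⇒x≡y; p⊆p∪q; q⊆p∪q; x∈p∪q⁻)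
open import Data.Fin.Subset.Induction using (Acc; acc; ⊃-wellFounded)
open import Data.Product using (_,_)
open import Data.Sum using (inj₁; inj₂)
open import Function.Definitions using (Injective)
open import Relation.Binary using (Rel; Decidable)
open import Relation.Binary.Construct.Closure.ReflexiveTransitive using (Star; ε; _◅_; _◅◅_; fold)
open import Relation.Binary.PropositionalEquality using (_≢_; refl; sym; trans; cong; subst; module ≡-Reasoning)
open import Relation.Nullary using (¬_; yes; no; contradiction; ¬?)
open import Relation.Nullary.Decidable using (map′; _×-dec_; _⊎-dec_; decidable-stable)
open import Relation.Unary using (Pred)
import Relation.Unary as U

private
  variable
    ℓ : Level
    m : ℕ

injective⇒onto : {f : Fin (suc m) → Fin (suc m)} → Injective _≡_ _≡_ f →
                 ∀ y → ∃[ x ] f x ≡ y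
injective⇒onto {f = f} f-inj y with any? (λ x → f x ≟ᶠ y)
... | yes hit = hit
... | no miss = contradiction (injective⇒≤ punchOut-y∘f-injective) 1+n≰n
  where
  y≢f : ∀ x → y ≢ f x
  y≢f x y≡fx = miss (x , sym y≡fx)
  punchOut-y∘f-injective : Injective _≡_ _≡_ (λ x → punchOut (y≢f x))
  punchOut-y∘f-injective eq = f-inj (punchOut-injective (y≢f _) (y≢f _) eq)

module FiniteReachability {n : ℕ} {E : Rel (Fin n) ℓ} (E? : Decidable E) where

  Closed : Subset n → Set ℓ
  Closed p = ∀ {a b} → a ∈ p → E a b → b ∈ p

  Closed⇒Star-closed : ∀ {p a b} → Closed p → a ∈ p → Star E a b → b ∈ p
  Closed⇒Star-closed closed a∈p ε        = a∈p
  Closed⇒Star-closed closed a∈p (e ◅ es) = Closed⇒Star-closed closed (closed a∈p e) es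

  record IsComponent (x : Fin n) (p : Subset n) : Set ℓ where
    field
      source    : x ∈ p
      closed    : Closed p
      reachable : ∀ {b} → b ∈ p → Star E x b

  private
    grow : ∀ {x} p → Acc _⊃_ p → x ∈ p → (∀ {b} → b ∈ p → Star E x b) → ∃[ q ] IsComponent x q
    grow p (acc larger) x∈p reach
      with any? (λ a → any? (λ b → a ∈? p ×-dec ¬? (b ∈? p) ×-dec E? a b))
    ... | no no-exit = p , record { source = x∈p ; closed = closed ; reachable = reach }
      where
      closed : Closed p
      closed {a} {b} a∈p e = decidable-stable (b ∈? p) (λ b∉p → no-exit (a , b , a∈p , b∉p , e))
    ... | yes (a , b , a∈p , b∉p , e) =
      grow (p ∪ ⁅ b ⁆) (larger p⊂p∪b) (p⊆p∪q ⁅ b ⁆ x∈p) reach′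
      where
      p⊂p∪b : p ⊂ p ∪ ⁅ b ⁆
      p⊂p∪b = p⊆p∪q ⁅ b ⁆ , b , q⊆p∪q p ⁅ b ⁆ (x∈⁅x⁆ b) , b∉p
      reach′ : ∀ {c} → c ∈ p ∪ ⁅ b ⁆ → Star E _ c
      reach′ c∈p∪b with x∈p∪q⁻ p ⁅ b ⁆ c∈p∪b
      ... | inj₁ c∈p = reach c∈p
      ... | inj₂ c∈b rewrite x∈⁅y⁆⇒x≡y b c∈b = reach a∈p ◅◅ e ◅ ε

  component : ∀ x → ∃[ p ] IsComponent x p
  component x = grow ⁅ x ⁆ (⊃-wellFounded _) (x∈⁅x⁆ x) reach
    where
    reach : ∀ {b} → b ∈ ⁅ x ⁆ → Star E x b
    reach b∈x rewrite x∈⁅y⁆⇒x≡y x b∈x = ε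

  Star? : Decidable (Star E)
  Star? x y =
    let p , p-component = component x
        open IsComponent p-component
    in map′ reachable (Closed⇒Star-closed closed source) (y ∈? p)

-- `next` is definitionally `position ∘ suc ∘ toℕ`.
position : ℕ → Fin (suc m)
position {m} j = fromℕ< (m%n<n j (suc m))

position-toℕ : (k : Fin (suc m)) → position (toℕ k) ≡ k
position-toℕ k = toℕ-injective (trans (toℕ-fromℕ< _) (m<n⇒m%n≡m (toℕ<n k)))

position-+-period : ∀ j → position {m} (j + suc m) ≡ position j
position-+-period {m} j = toℕ-injective (begin
  toℕ (position (j + suc m)) ≡⟨ toℕ-fromℕ< _ ⟩
  (j + suc m) % suc m       ≡⟨ [m+n]%n≡m%n j (suc m) ⟩
  j % suc m                 ≡⟨ toℕ-fromℕ< _ ⟨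
  toℕ (position j)          ∎)
  where open ≡-Reasoning

next-position : ∀ j → next (position {m} j) ≡ position (suc j)
next-position {m} j = toℕ-injective (begin
  toℕ (next (position j))             ≡⟨ toℕ-fromℕ< _ ⟩
  suc (toℕ (position j)) % suc m      ≡⟨ cong (λ r → suc r % suc m) (toℕ-fromℕ< _) ⟩
  (1 + j % suc m) % suc m             ≡⟨ %-distribˡ-+ 1 (j % suc m) (suc m) ⟩
  (1 % suc m + j % suc m % suc m) % suc m
                                      ≡⟨ cong (λ r → (1 % suc m + r) % suc m) (m%n%n≡m%n j (suc m)) ⟩
  (1 % suc m + j % suc m) % suc m     ≡⟨ %-distribˡ-+ 1 j (suc m) ⟨
  suc j % suc m                       ≡⟨ toℕ-fromℕ< _ ⟨
  toℕ (position (suc j))              ∎)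
  where open ≡-Reasoning

exit-ℕ : {P : Pred ℕ ℓ} → U.Decidable P → ∀ {i j} → i ≤ j → P i → ¬ P j →
         ∃[ k ] (P k × ¬ P (suc k))
exit-ℕ P? {j = zero}  z≤n Pi ¬Pj = contradiction Pi ¬Pj
exit-ℕ P? {j = suc j} i≤1+j Pi ¬P1+j with P? j
... | yes Pj = j , Pj , ¬P1+j
... | no ¬Pj with m≤n⇒m<n∨m≡n i≤1+j
...   | inj₁ (s≤s i≤j) = exit-ℕ P? i≤j Pi ¬Pj
...   | inj₂ refl      = contradiction Pi ¬P1+j

-- Going from a forward to b + one full turn, P must be lost at some step.
exit-cycle : {P : Pred (Fin (suc m)) ℓ} → U.Decidable P → ∀ {a b} → P a → ¬ P b →
             ∃[ k ] (P k × ¬ P (next k))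
exit-cycle {m} {P = P} P? {a} {b} Pa ¬Pb =
  let j , P[j] , ¬P[1+j] = exit-ℕ (λ j → P? (position j)) a≤b+turn P[a] ¬P[b+turn]
  in position j , P[j] , λ P[next] → ¬P[1+j] (subst P (next-position j) P[next])
  where
  a≤b+turn : toℕ a ≤ toℕ b + suc m
  a≤b+turn = ≤-trans (<⇒≤ (toℕ<n a)) (m≤n+m (suc m) (toℕ b))
  P[a] : P (position (toℕ a))
  P[a] = subst P (sym (position-toℕ a)) Pa
  ¬P[b+turn] : ¬ P (position (toℕ b + suc m))
  ¬P[b+turn] P[b+turn] = ¬Pb (subst P (trans (position-+-period (toℕ b)) (position-toℕ b)) P[b+turn])

module _ {G : Graph (suc m)} (H : HamCycle G) (S : SubA H) where
  open HamCycle H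

  FEdge? : Decidable (FEdge H S)
  FEdge? x y =
    any? (λ k → SubA.inV S k ≟ᵇ false ×-dec
                ((x ≟ᶠ v k ×-dec y ≟ᶠ v (next k)) ⊎-dec (y ≟ᶠ v k ×-dec x ≟ᶠ v (next k))))
    ⊎-dec any? (λ i → any? (λ j → SubA.red S i j ≟ᵇ true ×-dec x ≟ᶠ v (next i) ×-dec y ≟ᶠ v (next j)))
    ⊎-dec any? (λ i → any? (λ j → SubA.blue S i j ≟ᵇ true ×-dec x ≟ᶠ v i ×-dec y ≟ᶠ v j))

  Reach-trans : ∀ {x y z} → Reach H S x y → Reach H S y z → Reach H S x z
  Reach-trans here       r′ = r′
  Reach-trans (step e r) r′ = step e (Reach-trans r r′)

  Reach? : Decidable (Reach H S)
  Reach? x y = map′ (fold (Reach H S) step here) Reach⇒Star (FiniteReachability.Star? FEdge? x y)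
    where
    Reach⇒Star : ∀ {x y} → Reach H S x y → Star (FEdge H S) x y
    Reach⇒Star here       = ε
    Reach⇒Star (step e r) = e ◅ Reach⇒Star r

  leaving-edge-separates : ∀ {x k} → Reach H S x (v k) → ¬ Reach H S x (v (next k)) →
                           SubA.inV S k ≡ true × Separates H S k
  leaving-edge-separates {k = k} x↝k x↛next =
      ¬-not (λ k∉S → x↛next (Reach-trans x↝k (step (inj₁ (k , k∉S , inj₁ (refl , refl))) here)))
    , λ k↝next → x↛next (Reach-trans x↝k k↝next)

mainTheorem11 : (m : ℕ) → 3 ≤ suc m → (G : Graph (suc m)) → (H : HamCycle G) →
    (S : SubA H) → AltCycles H S → NoNeighbouring H S →
    Disconnected H S →
    ∃[ k ] (SubA.inV S k ≡ true × Separates H S k)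
mainTheorem11 m _ G H S _ _ (x , y , x↛y)
  with injective⇒onto (HamCycle.v-inj H) x | injective⇒onto (HamCycle.v-inj H) y
... | a , refl | b , refl =
  let k , a↝k , a↛next = exit-cycle (λ k → Reach? H S (HamCycle.v H a) (HamCycle.v H k)) here x↛y
  in k , leaving-edge-separates H S a↝k a↛next
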